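{- There is a number $R_0\ge 5$ such that for every integer $r\ge R_0$ and every integer $n\ge 4r$ there is a $(\frac14 r,\frac{1}{20r})$-single-neighbor expander $G=(V,W,E)$ with $|V|=|W|=n$ and $\deg(w)=r$ for all $w\in W$.
   Context: For a bipartite graph $G=(V,W,E)$ and $Y\subseteq W$, let $N(Y)$ be the set of vertices adjacent to some vertex of $Y$ (not in $Y$) and $N^*(Y)=\{v\in N(Y)\mid |N(v)\cap Y|=1\}$. For $0<\gamma<1$, $\alpha>1$, $G$ is an $(\alpha,\gamma)$-single-neighbor expander if every nonempty $Y\subseteq W$ with $|Y|\le\gamma|W|$ satisfies $|N^*(Y)|\ge\alpha|Y|$. -}

module Defs where

open import Data.Nat using (ℕ; _*_; _≤_; _<_; _≡ᵇ_)
open import Data.Bool using (Bool)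
open import Data.Fin using (Fin)
open import Data.Fin.Subset using (Subset; _∩_; ∣_∣; Nonempty)
open import Data.Vec using (tabulate)
open import Relation.Binary.PropositionalEquality using (_≡_)

BipGraph : ℕ → ℕ → Set
BipGraph nV nW = Fin nV → Fin nW → Bool

nbrW : ∀ {nV nW} → BipGraph nV nW → Fin nW → Subset nV
nbrW E w = tabulate (λ v → E v w)

nbrV : ∀ {nV nW} → BipGraph nV nW → Fin nV → Subset nW
nbrV E v = tabulate (λ w → E v w)

degW : ∀ {nV nW} → BipGraph nV nW → Fin nW → ℕ
degW E w = ∣ nbrW E w ∣

-- N*(Y) = { v ∈ N(Y) | |N(v) ∩ Y| = 1 }  (the condition |N(v) ∩ Y| = 1
-- already forces v ∈ N(Y); V and W are disjoint so "not in Y" is automatic)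
Nstar : ∀ {nV nW} → BipGraph nV nW → Subset nW → Subset nV
Nstar E Y = tabulate (λ v → ∣ nbrV E v ∩ Y ∣ ≡ᵇ 1)

-- (α, γ)-single-neighbor expander with rational parameters
-- α = αn / αd and γ = γn / γd (given as natural fractions),
-- subject to 0 < γ < 1 and α > 1.
record SingleNeighborExpander {nV nW : ℕ} (E : BipGraph nV nW)
         (αn αd γn γd : ℕ) : Set where
  field
    γ-pos   : 0 < γn
    γ-lt-1  : γn < γd
    α-gt-1  : αd < αn
    expand  : (Y : Subset nW) → Nonempty Y →
              γd * ∣ Y ∣ ≤ γn * nW →
              αn * ∣ Y ∣ ≤ αd * ∣ Nstar E Y ∣

-- Let b = ⌊n/r⌋ and cut r·b of the n vertices of V into r blocks of size b (the remaining vertices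
-- stay isolated). A choice of r layers assigns to every w ∈ W one vertex in each block, which makes
-- deg w = r. For Y ⊆ W of size k, run through Y inside one block and call an element a repeat if its
-- vertex was hit before; then k ≤ #(vertices hit exactly once) + 2·#repeats, and the vertices hit
-- exactly once lie in N*(Y). So fewer than q·k repeats in total, with 8q ≤ 3r, give r·k ≤ 4|N*(Y)|.
-- Each of the r·k steps is a repeat with probability at most k/b, so at most a fraction
-- 2^(rk) (k/b)^(qk) of all b^(rn) choices has q·k repeats; summing over the (n choose k) ≤ (4n/k)^k
-- sets of each size k with 20rk ≤ n gives at most 2^-k of all choices, so some choice is good for
-- every such Y simultaneously.

module Submission where

open import Defs
open import Data.Bool using (Bool; true; false; T; _∧_; if_then_else_)
open import Data.Bool.Properties using (T-≡; T-∧)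
open import Data.Fin using (Fin; toℕ) renaming (suc to fsuc)
open import Data.Fin.Properties using (toℕ<n)
open import Data.Fin.Subset using (Subset; _∩_; ∣_∣; Nonempty) renaming (_∈_ to _∈ₛ_)
open import Data.Fin.Subset.Properties using (∣p∣≤n; p⊆q⇒∣p∣≤∣q∣; ∣⁅x⁆∣≡1; x∈⁅y⁆⇒x≡y)
open import Data.List using (List; []; _∷_; _++_; map; length; tabulate; allFin; cartesianProductWith; _ʳ++_)
open import Data.List.Properties using (map-tabulate; length-tabulate)
open import Data.List.Membership.Propositional using (_∈_)
open import Data.List.Membership.Setoid.Properties using (∈-cartesianProductWith⁺)
open import Data.List.Relation.Unary.Any using (here; there)
open import Data.Nat
open import Data.Nat.DivMod using (_/_; _%_; m≡m%n+[m/n]*n; m%n<n; m*n/n≡m; m/n*n≤m; /-monoˡ-≤)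
open import Data.Nat.Properties
open import Data.Nat.Solver using (module +-*-Solver)
open import Data.Product using (Σ; ∃; _,_; _×_; proj₁; proj₂)
open import Data.Unit using (tt)
open import Data.Vec as Vec using (Vec; []; _∷_; lookup; toList; concat)
open import Data.Vec.Properties using (tabulate-cong; length-toList)
open import Function using (_∘_)
open import Function.Bundles using (Equivalence)
open import Relation.Binary.PropositionalEquality

open +-*-Solver

𝟙 : Bool → ℕ
𝟙 true = 1
𝟙 false = 0

𝟙≤1 : ∀ b → 𝟙 b ≤ 1
𝟙≤1 true = ≤-refl
𝟙≤1 false = z≤n

∑ : ∀ {a} {A : Set a} → List A → (A → ℕ) → ℕ
∑ [] g = 0
∑ (x ∷ xs) g = g x + ∑ xs g

syntax ∑ xs (λ x → e) = ∑[ x ∈ xs ] e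

module _ {a} {A : Set a} where

  ∑-++ : ∀ xs ys (g : A → ℕ) → ∑ (xs ++ ys) g ≡ ∑ xs g + ∑ ys g
  ∑-++ [] ys g = refl
  ∑-++ (x ∷ xs) ys g = trans (cong (g x +_) (∑-++ xs ys g)) (sym (+-assoc (g x) _ _))

  ∑-cong : ∀ xs {g h : A → ℕ} → (∀ x → g x ≡ h x) → ∑ xs g ≡ ∑ xs h
  ∑-cong [] e = refl
  ∑-cong (x ∷ xs) e = cong₂ _+_ (e x) (∑-cong xs e)

  ∑-mono-≤ : ∀ xs {g h : A → ℕ} → (∀ x → g x ≤ h x) → ∑ xs g ≤ ∑ xs h
  ∑-mono-≤ [] e = z≤n
  ∑-mono-≤ (x ∷ xs) e = +-mono-≤ (e x) (∑-mono-≤ xs e)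

  ∑-distrib-+ : ∀ xs (g h : A → ℕ) → ∑[ x ∈ xs ] (g x + h x) ≡ ∑ xs g + ∑ xs h
  ∑-distrib-+ [] g h = refl
  ∑-distrib-+ (x ∷ xs) g h rewrite ∑-distrib-+ xs g h =
    solve 4 (λ a c d e → a :+ c :+ (d :+ e) := a :+ d :+ (c :+ e)) refl (g x) (h x) (∑ xs g) (∑ xs h)

  ∑-*ˡ : ∀ xs c (g : A → ℕ) → ∑[ x ∈ xs ] (c * g x) ≡ c * ∑ xs g
  ∑-*ˡ [] c g = sym (*-zeroʳ c)
  ∑-*ˡ (x ∷ xs) c g = trans (cong (c * g x +_) (∑-*ˡ xs c g)) (sym (*-distribˡ-+ c (g x) _))

  ∑-*ʳ : ∀ xs c (g : A → ℕ) → ∑[ x ∈ xs ] (g x * c) ≡ ∑ xs g * c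
  ∑-*ʳ xs c g = trans (∑-cong xs (λ x → *-comm (g x) c)) (trans (∑-*ˡ xs c g) (*-comm c _))

  ∑-const : ∀ (xs : List A) c → ∑[ x ∈ xs ] c ≡ c * length xs
  ∑-const [] c = sym (*-zeroʳ c)
  ∑-const (x ∷ xs) c = trans (cong (c +_) (∑-const xs c)) (sym (*-suc c (length xs)))

  ∑-1 : ∀ (xs : List A) → ∑[ x ∈ xs ] 1 ≡ length xs
  ∑-1 xs = trans (∑-const xs 1) (*-identityˡ _)

  ∑-0 : ∀ xs {g : A → ℕ} → (∀ x → g x ≡ 0) → ∑ xs g ≡ 0
  ∑-0 [] e = refl
  ∑-0 (x ∷ xs) e = cong₂ _+_ (e x) (∑-0 xs e)

  ∑-𝟙≤length : ∀ xs (p : A → Bool) → ∑[ x ∈ xs ] 𝟙 (p x) ≤ length xs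
  ∑-𝟙≤length xs p = ≤-trans (∑-mono-≤ xs (λ x → 𝟙≤1 (p x))) (≤-reflexive (∑-1 xs))

  ∈⇒≤∑ : ∀ {x xs} (g : A → ℕ) → x ∈ xs → g x ≤ ∑ xs g
  ∈⇒≤∑ g (here refl) = m≤m+n _ _
  ∈⇒≤∑ {xs = y ∷ _} g (there x∈xs) = ≤-trans (∈⇒≤∑ g x∈xs) (m≤n+m _ (g y))

  ∑<length⇒∃≡0 : ∀ xs (g : A → ℕ) → ∑ xs g < length xs → ∃ λ x → g x ≡ 0
  ∑<length⇒∃≡0 (x ∷ xs) g lt with g x in eq
  ... | zero = x , eq
  ... | suc k = ∑<length⇒∃≡0 xs g (≤-trans (s≤s (m≤n+m _ k)) (s≤s⁻¹ lt))

  ∑[𝟙*g]≤∑𝟙*C : ∀ xs (p : A → Bool) (g : A → ℕ) C → (∀ x → T (p x) → g x ≤ C) →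
              ∑[ x ∈ xs ] (𝟙 (p x) * g x) ≤ (∑[ x ∈ xs ] 𝟙 (p x)) * C
  ∑[𝟙*g]≤∑𝟙*C xs p g C bound = ≤-trans (∑-mono-≤ xs pointwise) (≤-reflexive (∑-*ʳ xs C (𝟙 ∘ p)))
    where
    pointwise : ∀ x → 𝟙 (p x) * g x ≤ 𝟙 (p x) * C
    pointwise x with p x in e
    ... | true = *-monoʳ-≤ 1 (bound x (subst T (sym e) _))
    ... | false = z≤n

∑-ʳ++ : ∀ {a} {A : Set a} (xs ys : List A) (g : A → ℕ) → ∑ (xs ʳ++ ys) g ≡ ∑ xs g + ∑ ys g
∑-ʳ++ [] ys g = refl
∑-ʳ++ (x ∷ xs) ys g = trans (∑-ʳ++ xs (x ∷ ys) g)
  (solve 3 (λ a c d → c :+ (a :+ d) := a :+ c :+ d) refl (g x) (∑ xs g) (∑ ys g))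

module _ {a b} {A : Set a} {B : Set b} where

  ∑-map : ∀ (f : A → B) xs (g : B → ℕ) → ∑ (map f xs) g ≡ ∑ xs (g ∘ f)
  ∑-map f [] g = refl
  ∑-map f (x ∷ xs) g = cong (g (f x) +_) (∑-map f xs g)

  ∑-comm : ∀ xs ys (g : A → B → ℕ) → ∑[ x ∈ xs ] ∑ ys (g x) ≡ ∑[ y ∈ ys ] ∑[ x ∈ xs ] g x y
  ∑-comm [] ys g = sym (∑-0 ys (λ _ → refl))
  ∑-comm (x ∷ xs) ys g = trans (cong (∑ ys (g x) +_) (∑-comm xs ys g)) (sym (∑-distrib-+ ys (g x) _))

∑< : ℕ → (ℕ → ℕ) → ℕ
∑< zero h = 0
∑< (suc m) h = h 0 + ∑< m (h ∘ suc)

∑<-cong : ∀ m {g h : ℕ → ℕ} → (∀ j → j < m → g j ≡ h j) → ∑< m g ≡ ∑< m h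
∑<-cong zero e = refl
∑<-cong (suc m) e = cong₂ _+_ (e 0 z<s) (∑<-cong m (λ j j<m → e (suc j) (s<s j<m)))

∑<-mono-≤ : ∀ m {g h : ℕ → ℕ} → (∀ j → g j ≤ h j) → ∑< m g ≤ ∑< m h
∑<-mono-≤ zero e = z≤n
∑<-mono-≤ (suc m) e = +-mono-≤ (e 0) (∑<-mono-≤ m (e ∘ suc))

∑<-distrib-+ : ∀ m (g h : ℕ → ℕ) → ∑< m (λ j → g j + h j) ≡ ∑< m g + ∑< m h
∑<-distrib-+ zero g h = refl
∑<-distrib-+ (suc m) g h rewrite ∑<-distrib-+ m (g ∘ suc) (h ∘ suc) = solve 4
  (λ a c d e → a :+ c :+ (d :+ e) := a :+ d :+ (c :+ e)) refl (g 0) (h 0) (∑< m (g ∘ suc)) (∑< m (h ∘ suc))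

∑<-0 : ∀ m {h : ℕ → ℕ} → (∀ j → h j ≡ 0) → ∑< m h ≡ 0
∑<-0 zero e = refl
∑<-0 (suc m) e = cong₂ _+_ (e 0) (∑<-0 m (e ∘ suc))

∑<-+ : ∀ m o h → ∑< (m + o) h ≡ ∑< m h + ∑< o (λ j → h (m + j))
∑<-+ zero o h = refl
∑<-+ (suc m) o h = trans (cong (h 0 +_) (∑<-+ m o (h ∘ suc))) (sym (+-assoc (h 0) _ _))

∑<-suc : ∀ m h → ∑< (suc m) h ≡ ∑< m h + h m
∑<-suc zero h = +-comm (h 0) 0
∑<-suc (suc m) h = trans (cong (h 0 +_) (∑<-suc m (h ∘ suc))) (sym (+-assoc (h 0) _ _))

∑<-δ : ∀ m {s} (g : ℕ → ℕ) → s < m → ∑< m (λ j → 𝟙 (s ≡ᵇ j) * g j) ≡ g s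
∑<-δ (suc m) {zero} g _ = trans (cong (g 0 + 0 +_) (∑<-0 m (λ _ → refl))) (trans (+-identityʳ _) (+-identityʳ _))
∑<-δ (suc m) {suc s} g s<m = ∑<-δ m (g ∘ suc) (s<s⁻¹ s<m)

∑<-𝟙≡ᵇ : ∀ m {s} → s < m → ∑< m (λ j → 𝟙 (s ≡ᵇ j)) ≡ 1
∑<-𝟙≡ᵇ m s<m = trans (∑<-cong m (λ j _ → sym (*-identityʳ _))) (∑<-δ m (λ _ → 1) s<m)

∑<-monoˡ-≤ : ∀ {m n} (h : ℕ → ℕ) → m ≤ n → ∑< m h ≤ ∑< n h
∑<-monoˡ-≤ {m} {n} h m≤n = begin
    ∑< m h
  ≤⟨ m≤m+n _ _ ⟩
    ∑< m h + ∑< (n ∸ m) (λ j → h (m + j))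
  ≡⟨ sym (∑<-+ m (n ∸ m) h) ⟩
    ∑< (m + (n ∸ m)) h
  ≡⟨ cong (λ z → ∑< z h) (m+[n∸m]≡n m≤n) ⟩
    ∑< n h
  ∎
  where open ≤-Reasoning

∑<-vanishing : ∀ {m n} (h : ℕ → ℕ) → m ≤ n → (∀ t → h (m + t) ≡ 0) → ∑< n h ≡ ∑< m h
∑<-vanishing {m} {n} h m≤n vanish = begin
    ∑< n h
  ≡⟨ cong (λ z → ∑< z h) (sym (m+[n∸m]≡n m≤n)) ⟩
    ∑< (m + (n ∸ m)) h
  ≡⟨ ∑<-+ m (n ∸ m) h ⟩
    ∑< m h + ∑< (n ∸ m) (λ t → h (m + t))
  ≡⟨ cong (∑< m h +_) (∑<-0 (n ∸ m) vanish) ⟩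
    ∑< m h + 0
  ≡⟨ +-identityʳ _ ⟩
    ∑< m h
  ∎
  where open ≡-Reasoning

∑-∑<-comm : ∀ {a} {A : Set a} (xs : List A) m (g : A → ℕ → ℕ) →
            ∑[ x ∈ xs ] ∑< m (g x) ≡ ∑< m (λ j → ∑[ x ∈ xs ] g x j)
∑-∑<-comm [] m g = sym (∑<-0 m (λ _ → refl))
∑-∑<-comm (x ∷ xs) m g = trans (cong (∑< m (g x) +_) (∑-∑<-comm xs m g)) (sym (∑<-distrib-+ m (g x) _))

∑-by-size : ∀ {a} {A : Set a} (xs : List A) (size : A → ℕ) m (g : A → ℕ → ℕ) → (∀ x → size x < m) →
            ∑[ x ∈ xs ] g x (size x) ≡ ∑< m (λ k → ∑[ x ∈ xs ] (𝟙 (size x ≡ᵇ k) * g x k))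
∑-by-size xs size m g size<m =
  trans (∑-cong xs (λ x → sym (∑<-δ m (g x) (size<m x)))) (∑-∑<-comm xs m _)

∑-allFin : ∀ n (h : ℕ → ℕ) → ∑[ i ∈ allFin n ] h (toℕ i) ≡ ∑< n h
∑-allFin zero h = refl
∑-allFin (suc n) h = cong (h 0 +_) (begin
    ∑ (tabulate {n = n} fsuc) (h ∘ toℕ)
  ≡⟨ cong (λ is → ∑ is (h ∘ toℕ)) (sym (map-tabulate {n = n} (λ i → i) fsuc)) ⟩
    ∑ (map fsuc (allFin n)) (h ∘ toℕ)
  ≡⟨ ∑-map fsuc (allFin n) (h ∘ toℕ) ⟩
    ∑[ i ∈ allFin n ] h (suc (toℕ i))
  ≡⟨ ∑-allFin n (h ∘ suc) ⟩
    ∑< n (h ∘ suc)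
  ∎)
  where open ≡-Reasoning

module _ {a b c} {A : Set a} {B : Set b} {C : Set c} where

  ∑-cartesianProductWith : ∀ (f : A → B → C) xs ys (g : C → ℕ) →
                           ∑ (cartesianProductWith f xs ys) g ≡ ∑[ x ∈ xs ] ∑[ y ∈ ys ] g (f x y)
  ∑-cartesianProductWith f [] ys g = refl
  ∑-cartesianProductWith f (x ∷ xs) ys g =
    trans (∑-++ (map (f x) ys) _ g) (cong₂ _+_ (∑-map (f x) ys g) (∑-cartesianProductWith f xs ys g))

module _ {a} {A : Set a} where

  allVec : List A → ∀ L → List (Vec A L)
  allVec xs zero = [] ∷ []
  allVec xs (suc L) = cartesianProductWith _∷_ xs (allVec xs L)

  ∑-allVec-suc : ∀ xs L (g : Vec A (suc L) → ℕ) → ∑ (allVec xs (suc L)) g ≡ ∑[ x ∈ xs ] ∑[ v ∈ allVec xs L ] g (x ∷ v)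
  ∑-allVec-suc xs L = ∑-cartesianProductWith _∷_ xs (allVec xs L)

  length-allVec : ∀ xs L → length (allVec xs L) ≡ length xs ^ L
  length-allVec xs zero = refl
  length-allVec xs (suc L) = begin
      length (allVec xs (suc L))
    ≡⟨ sym (∑-1 (allVec xs (suc L))) ⟩
      ∑[ v ∈ allVec xs (suc L) ] 1
    ≡⟨ ∑-allVec-suc xs L (λ _ → 1) ⟩
      ∑[ x ∈ xs ] ∑[ v ∈ allVec xs L ] 1
    ≡⟨ ∑-cong xs (λ _ → trans (∑-1 (allVec xs L)) (length-allVec xs L)) ⟩
      ∑[ x ∈ xs ] (length xs ^ L)
    ≡⟨ trans (∑-const xs _) (*-comm _ (length xs)) ⟩
      length xs ^ suc L
    ∎
    where open ≡-Reasoning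

  ∈-allVec : ∀ {xs} → (∀ x → x ∈ xs) → ∀ {L} (v : Vec A L) → v ∈ allVec xs L
  ∈-allVec complete [] = here refl
  ∈-allVec complete (x ∷ v) = ∈-cartesianProductWith⁺ (setoid A) (setoid (Vec A _)) (setoid (Vec A _)) (cong₂ _∷_)
    (complete x) (∈-allVec complete v)

-- Adaptive tests

suc≤ᵇsuc : ∀ m n → (suc m ≤ᵇ suc n) ≡ (m ≤ᵇ n)
suc≤ᵇsuc zero n = refl
suc≤ᵇsuc (suc m) n = refl

module AdaptiveTests (b K : ℕ) where

  words : ∀ L → List (Vec (Fin b) L)
  words = allVec (allFin b)

  data Strategy : ℕ → ℕ → Set where
    stop : Strategy 0 0
    read : ∀ {L t} → (Fin b → Strategy L t) → Strategy (suc L) t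
    test : ∀ {L t} (S : Fin b → Bool) → ∑[ x ∈ allFin b ] 𝟙 (S x) ≤ K →
           (Fin b → Strategy L t) → Strategy (suc L) (suc t)

  passed : ∀ {L t} → Strategy L t → Vec (Fin b) L → ℕ
  passed stop [] = 0
  passed (read σ) (x ∷ w) = passed (σ x) w
  passed (test S _ σ) (x ∷ w) = 𝟙 (S x) + passed (σ x) w

  #passing≥ : ∀ {L t} → Strategy L t → ℕ → ℕ
  #passing≥ {L} σ m = ∑[ w ∈ words L ] 𝟙 (m ≤ᵇ passed σ w)

  #passing≥-read : ∀ {L t} (σ : Fin b → Strategy L t) m →
                   #passing≥ (read σ) m ≡ ∑[ x ∈ allFin b ] #passing≥ (σ x) m
  #passing≥-read {L} σ m = ∑-allVec-suc (allFin b) L _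

  #passing≥-test : ∀ {L t} S S≤K (σ : Fin b → Strategy L t) m →
                   #passing≥ (test S S≤K σ) (suc m) ≡
                   ∑[ x ∈ allFin b ] (if S x then #passing≥ (σ x) m else #passing≥ (σ x) (suc m))
  #passing≥-test {L} S S≤K σ m = trans (∑-allVec-suc (allFin b) L _) (∑-cong (allFin b) passing)
    where
    passing : ∀ x → ∑[ w ∈ words L ] 𝟙 (suc m ≤ᵇ 𝟙 (S x) + passed (σ x) w) ≡
                    (if S x then #passing≥ (σ x) m else #passing≥ (σ x) (suc m))
    passing x with S x
    ... | true = ∑-cong (words L) (λ w → cong 𝟙 (suc≤ᵇsuc m (passed (σ x) w)))
    ... | false = refl

  #passing≥≤#words : ∀ {L t} (σ : Strategy L t) m → #passing≥ σ m ≤ b ^ L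
  #passing≥≤#words {L} σ m = ≤-trans (∑-𝟙≤length (words L) _)
    (≤-reflexive (trans (length-allVec (allFin b) L) (cong (_^ L) (length-tabulate (λ x → x)))))

  if-bound : ∀ s {c₀ c₁ m A} → c₀ * b ^ m ≤ A → c₁ * b ^ suc m ≤ K * A →
             (if s then c₀ else c₁) * b ^ suc m ≤ 𝟙 s * (b * A) + K * A
  if-bound true {c₀} {m = m} {A} c₀≤ _ = begin
      c₀ * (b * b ^ m)
    ≡⟨ solve 3 (λ c u v → c :* (u :* v) := u :* (c :* v)) refl c₀ b (b ^ m) ⟩
      b * (c₀ * b ^ m)
    ≤⟨ *-monoʳ-≤ b c₀≤ ⟩
      b * A
    ≡⟨ sym (+-identityʳ (b * A)) ⟩
      1 * (b * A)
    ≤⟨ m≤m+n _ (K * A) ⟩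
      1 * (b * A) + K * A
    ∎
    where open ≤-Reasoning
  if-bound false _ c₁≤ = c₁≤

  -- The counting form of: when each of t adaptive tests is passed with probability at most K/b,
  -- at least m of them are passed with probability at most 2^t (K/b)^m.
  #passing≥-bound : ∀ {L t} (σ : Strategy L t) m → #passing≥ σ m * b ^ m ≤ 2 ^ t * K ^ m * b ^ L
  #passing≥-bound stop zero = ≤-refl
  #passing≥-bound stop (suc m) = z≤n
  #passing≥-bound {suc L} {t} (read σ) m = begin
      #passing≥ (read σ) m * b ^ m
    ≡⟨ trans (cong (_* b ^ m) (#passing≥-read σ m)) (sym (∑-*ʳ (allFin b) _ _)) ⟩
      ∑[ x ∈ allFin b ] (#passing≥ (σ x) m * b ^ m)
    ≤⟨ ∑-mono-≤ (allFin b) (λ x → #passing≥-bound (σ x) m) ⟩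
      ∑[ x ∈ allFin b ] (2 ^ t * K ^ m * b ^ L)
    ≡⟨ trans (∑-const (allFin b) _) (cong (2 ^ t * K ^ m * b ^ L *_) (length-tabulate (λ x → x))) ⟩
      2 ^ t * K ^ m * b ^ L * b
    ≡⟨ solve 4 (λ u v w z → u :* v :* w :* z := u :* v :* (z :* w)) refl (2 ^ t) (K ^ m) (b ^ L) b ⟩
      2 ^ t * K ^ m * b ^ suc L
    ∎
    where open ≤-Reasoning
  #passing≥-bound {suc L} {suc t} σ@(test _ _ _) zero = begin
      #passing≥ σ 0 * 1
    ≡⟨ *-identityʳ _ ⟩
      #passing≥ σ 0
    ≤⟨ #passing≥≤#words σ 0 ⟩
      b ^ suc L
    ≤⟨ m≤n*m (b ^ suc L) (2 ^ suc t) {{m^n≢0 2 (suc t)}} ⟩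
      2 ^ suc t * b ^ suc L
    ≡⟨ cong (_* b ^ suc L) (sym (*-identityʳ (2 ^ suc t))) ⟩
      2 ^ suc t * 1 * b ^ suc L
    ∎
    where open ≤-Reasoning
  #passing≥-bound {suc L} {suc t} (test S S≤K σ) (suc m) = begin
      #passing≥ (test S S≤K σ) (suc m) * b ^ suc m
    ≡⟨ trans (cong (_* b ^ suc m) (#passing≥-test S S≤K σ m)) (sym (∑-*ʳ (allFin b) _ _)) ⟩
      ∑[ x ∈ allFin b ] ((if S x then #passing≥ (σ x) m else #passing≥ (σ x) (suc m)) * b ^ suc m)
    ≤⟨ ∑-mono-≤ (allFin b) (λ x → if-bound (S x) {m = m} (#passing≥-bound (σ x) m) (passing-suc x)) ⟩
      ∑[ x ∈ allFin b ] (𝟙 (S x) * (b * A) + K * A)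
    ≡⟨ ∑-distrib-+ (allFin b) _ _ ⟩
      ∑[ x ∈ allFin b ] (𝟙 (S x) * (b * A)) + ∑[ x ∈ allFin b ] (K * A)
    ≡⟨ cong₂ _+_ (∑-*ʳ (allFin b) (b * A) _) (trans (∑-const (allFin b) (K * A)) (cong (K * A *_) (length-tabulate (λ x → x)))) ⟩
      (∑[ x ∈ allFin b ] 𝟙 (S x)) * (b * A) + K * A * b
    ≤⟨ +-monoˡ-≤ (K * A * b) (*-monoˡ-≤ (b * A) S≤K) ⟩
      K * (b * A) + K * A * b
    ≡⟨ solve 5 (λ k a bb u v → k :* (bb :* (u :* v :* a)) :+ k :* (u :* v :* a) :* bb := (con 2 :* u) :* (k :* v) :* (bb :* a))
         refl K (b ^ L) b (2 ^ t) (K ^ m) ⟩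
      2 ^ suc t * K ^ suc m * b ^ suc L
    ∎
    where
    open ≤-Reasoning
    A : ℕ
    A = 2 ^ t * K ^ m * b ^ L
    passing-suc : ∀ x → #passing≥ (σ x) (suc m) * b ^ suc m ≤ K * A
    passing-suc x = ≤-trans (#passing≥-bound (σ x) (suc m))
      (≤-reflexive (solve 4 (λ u k v w → u :* (k :* v) :* w := k :* (u :* v :* w)) refl (2 ^ t) K (K ^ m) (b ^ L)))

-- Singletons and repeats in a list

𝟙-0<ᵇ≤ : ∀ n → 𝟙 (0 <ᵇ n) ≤ n
𝟙-0<ᵇ≤ zero = z≤n
𝟙-0<ᵇ≤ (suc n) = s≤s z≤n

module Collisions (b : ℕ) where

  occurrences : ℕ → List (Fin b) → ℕ
  occurrences j l = ∑[ x ∈ l ] 𝟙 (toℕ x ≡ᵇ j)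

  occursIn : List (Fin b) → Fin b → Bool
  occursIn l x = 0 <ᵇ occurrences (toℕ x) l

  ∑-occursIn≤length : ∀ l → ∑[ x ∈ allFin b ] 𝟙 (occursIn l x) ≤ length l
  ∑-occursIn≤length l = begin
      ∑[ x ∈ allFin b ] 𝟙 (occursIn l x)
    ≤⟨ ∑-mono-≤ (allFin b) (λ x → 𝟙-0<ᵇ≤ (occurrences (toℕ x) l)) ⟩
      ∑[ x ∈ allFin b ] occurrences (toℕ x) l
    ≡⟨ ∑-comm (allFin b) l _ ⟩
      ∑[ y ∈ l ] ∑[ x ∈ allFin b ] 𝟙 (toℕ y ≡ᵇ toℕ x)
    ≡⟨ ∑-cong l (λ y → trans (∑-allFin b _) (∑<-𝟙≡ᵇ b (toℕ<n y))) ⟩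
      ∑[ y ∈ l ] 1
    ≡⟨ ∑-1 l ⟩
      length l
    ∎
    where open ≤-Reasoning

  singletons : List (Fin b) → ℕ
  singletons l = ∑< b (λ j → 𝟙 (occurrences j l ≡ᵇ 1))

  repeats : List (Fin b) → List (Fin b) → ℕ
  repeats prev [] = 0
  repeats prev (x ∷ l) = 𝟙 (occursIn prev x) + repeats (x ∷ prev) l

  singletons-∷-new : ∀ prev x → occurrences (toℕ x) prev ≡ 0 → singletons prev + 1 ≤ singletons (x ∷ prev)
  singletons-∷-new prev x new = begin
      singletons prev + 1
    ≡⟨ cong (singletons prev +_) (sym (∑<-𝟙≡ᵇ b (toℕ<n x))) ⟩
      singletons prev + ∑< b (λ j → 𝟙 (toℕ x ≡ᵇ j))
    ≡⟨ sym (∑<-distrib-+ b _ _) ⟩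
      ∑< b (λ j → 𝟙 (occurrences j prev ≡ᵇ 1) + 𝟙 (toℕ x ≡ᵇ j))
    ≤⟨ ∑<-mono-≤ b pointwise ⟩
      singletons (x ∷ prev)
    ∎
    where
    open ≤-Reasoning
    pointwise : ∀ j → 𝟙 (occurrences j prev ≡ᵇ 1) + 𝟙 (toℕ x ≡ᵇ j) ≤ 𝟙 (𝟙 (toℕ x ≡ᵇ j) + occurrences j prev ≡ᵇ 1)
    pointwise j with toℕ x ≡ᵇ j in x≡j
    ... | true rewrite sym (≡ᵇ⇒≡ (toℕ x) j (subst T (sym x≡j) _)) | new = ≤-refl
    ... | false = ≤-reflexive (+-identityʳ _)

  singletons-∷-old : ∀ prev x → singletons prev ≤ singletons (x ∷ prev) + 1
  singletons-∷-old prev x = begin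
      singletons prev
    ≤⟨ ∑<-mono-≤ b pointwise ⟩
      ∑< b (λ j → 𝟙 (occurrences j (x ∷ prev) ≡ᵇ 1) + 𝟙 (toℕ x ≡ᵇ j))
    ≡⟨ ∑<-distrib-+ b _ _ ⟩
      singletons (x ∷ prev) + ∑< b (λ j → 𝟙 (toℕ x ≡ᵇ j))
    ≡⟨ cong (singletons (x ∷ prev) +_) (∑<-𝟙≡ᵇ b (toℕ<n x)) ⟩
      singletons (x ∷ prev) + 1
    ∎
    where
    open ≤-Reasoning
    pointwise : ∀ j → 𝟙 (occurrences j prev ≡ᵇ 1) ≤ 𝟙 (𝟙 (toℕ x ≡ᵇ j) + occurrences j prev ≡ᵇ 1) + 𝟙 (toℕ x ≡ᵇ j)
    pointwise j with toℕ x ≡ᵇ j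
    ... | true = ≤-trans (𝟙≤1 _) (m≤n+m 1 _)
    ... | false = ≤-reflexive (sym (+-identityʳ _))

  -- A new letter creates a singleton; a repeated one destroys at most one.
  singletons-∷ : ∀ prev x → singletons prev + 1 ≤ singletons (x ∷ prev) + 2 * 𝟙 (occursIn prev x)
  singletons-∷ prev x with occurrences (toℕ x) prev in occ
  ... | zero = ≤-trans (singletons-∷-new prev x occ) (≤-reflexive (sym (+-identityʳ _)))
  ... | suc _ = ≤-trans (+-monoˡ-≤ 1 (singletons-∷-old prev x)) (≤-reflexive (+-assoc _ 1 1))

  singletons+length≤ : ∀ prev l → singletons prev + length l ≤ singletons (l ʳ++ prev) + 2 * repeats prev l
  singletons+length≤ prev [] = ≤-refl
  singletons+length≤ prev (x ∷ l) = begin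
      singletons prev + suc (length l)
    ≡⟨ sym (+-assoc (singletons prev) 1 (length l)) ⟩
      singletons prev + 1 + length l
    ≤⟨ +-monoˡ-≤ (length l) (singletons-∷ prev x) ⟩
      singletons (x ∷ prev) + 2 * r + length l
    ≡⟨ solve 3 (λ s h n → s :+ con 2 :* h :+ n := s :+ n :+ con 2 :* h) refl (singletons (x ∷ prev)) r (length l) ⟩
      singletons (x ∷ prev) + length l + 2 * r
    ≤⟨ +-monoˡ-≤ (2 * r) (singletons+length≤ (x ∷ prev) l) ⟩
      singletons (l ʳ++ x ∷ prev) + 2 * repeats (x ∷ prev) l + 2 * r
    ≡⟨ solve 3 (λ s h g → s :+ con 2 :* g :+ con 2 :* h := s :+ con 2 :* (h :+ g)) refl (singletons (l ʳ++ x ∷ prev)) r (repeats (x ∷ prev) l) ⟩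
      singletons (l ʳ++ x ∷ prev) + 2 * repeats prev (x ∷ l)
    ∎
    where
    open ≤-Reasoning
    r = 𝟙 (occursIn prev x)

  length≤singletons+2*repeats : ∀ l → length l ≤ singletons l + 2 * repeats [] l
  length≤singletons+2*repeats l = begin
      length l
    ≤⟨ m≤n+m (length l) (singletons []) ⟩
      singletons [] + length l
    ≤⟨ singletons+length≤ [] l ⟩
      singletons (l ʳ++ []) + 2 * repeats [] l
    ≡⟨ cong (_+ 2 * repeats [] l) (∑<-cong b (λ j _ → cong (λ c → 𝟙 (c ≡ᵇ 1)) (trans (∑-ʳ++ l [] _) (+-identityʳ _)))) ⟩
      singletons l + 2 * repeats [] l
    ∎
    where open ≤-Reasoning

^-distribʳ-* : ∀ m n k → (m * n) ^ k ≡ m ^ k * n ^ k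
^-distribʳ-* m n zero = refl
^-distribʳ-* m n (suc k) = trans (cong (m * n *_) (^-distribʳ-* m n k))
  (solve 4 (λ x y u v → x :* y :* (u :* v) := x :* u :* (y :* v)) refl m n (m ^ k) (n ^ k))

bernoulli : ∀ n k → n ^ suc k + suc k * n ^ k ≤ suc n ^ suc k
bernoulli n zero = ≤-reflexive (solve 1 (λ x → x :* con 1 :+ con 1 :* con 1 := (con 1 :+ x) :* con 1) refl n)
bernoulli n (suc k) = begin
    n * (n * n ^ k) + suc (suc k) * (n * n ^ k)
  ≤⟨ m≤m+n _ (suc k * n ^ k) ⟩
    n * (n * n ^ k) + suc (suc k) * (n * n ^ k) + suc k * n ^ k
  ≡⟨ solve 3 (λ m i x → m :* (m :* x) :+ (con 2 :+ i) :* (m :* x) :+ (con 1 :+ i) :* x :=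
                        (con 1 :+ m) :* (m :* x :+ (con 1 :+ i) :* x)) refl n k (n ^ k) ⟩
    suc n * (n ^ suc k + suc k * n ^ k)
  ≤⟨ *-monoʳ-≤ (suc n) (bernoulli n k) ⟩
    suc n * suc n ^ suc k
  ∎
  where open ≤-Reasoning

-- In real terms (1 + 1/m)^j ≤ m/d for m = j + d; the induction trades one unit of j for one of d.
[1+j+d]^j*d≤[j+d]^[1+j] : ∀ j d → suc (j + d) ^ j * d ≤ (j + d) ^ suc j
[1+j+d]^j*d≤[j+d]^[1+j] zero d = ≤-reflexive (*-comm 1 d)
[1+j+d]^j*d≤[j+d]^[1+j] (suc j) d = begin
    suc m * suc m ^ j * d
  ≡⟨ solve 3 (λ i a e → (con 1 :+ i) :* a :* e := a :* ((con 1 :+ i) :* e)) refl m (suc m ^ j) d ⟩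
    suc m ^ j * (suc m * d)
  ≤⟨ *-monoʳ-≤ (suc m ^ j) [1+m]*d≤m*[1+d] ⟩
    suc m ^ j * (m * suc d)
  ≡⟨ solve 3 (λ i a e → a :* (i :* e) := i :* (a :* e)) refl m (suc m ^ j) (suc d) ⟩
    m * (suc m ^ j * suc d)
  ≤⟨ *-monoʳ-≤ m (subst (λ z → suc z ^ j * suc d ≤ z ^ suc j) (+-suc j d) ([1+j+d]^j*d≤[j+d]^[1+j] j (suc d))) ⟩
    m * m ^ suc j
  ∎
  where
  open ≤-Reasoning
  m = suc (j + d)
  [1+m]*d≤m*[1+d] : suc m * d ≤ m * suc d
  [1+m]*d≤m*[1+d] = begin
      suc m * d
    ≡⟨ +-comm d (m * d) ⟩
      m * d + d
    ≤⟨ +-monoʳ-≤ (m * d) (≤-trans (m≤n+m d j) (n≤1+n _)) ⟩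
      m * d + m
    ≡⟨ solve 2 (λ i e → i :* e :+ i := i :* (con 1 :+ e)) refl m d ⟩
      m * suc d
    ∎

[1+k]^k≤4*k^k : ∀ k → suc k ^ k ≤ 4 * k ^ k
[1+k]^k≤4*k^k zero = s≤s z≤n
[1+k]^k≤4*k^k k@(suc _) = *-cancelˡ-≤ (2 ^ k) {{m^n≢0 2 k}} (begin
    2 ^ k * suc k ^ k
  ≡⟨ sym (^-distribʳ-* 2 (suc k) k) ⟩
    (2 * suc k) ^ k
  ≤⟨ halve (suc (k + k)) (suc k) {(2 * suc k) ^ k} [2+2k]^k*[1+k]≤[1+2k]^[1+k]
      (≤-trans (s≤s (+-monoʳ-≤ k (n≤1+n k))) (≤-reflexive (cong (suc k +_) (sym (+-identityʳ (suc k)))))) ⟩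
    2 * suc (k + k) ^ k
  ≤⟨ *-monoʳ-≤ 2 (halve (k + k) k {suc (k + k) ^ k} [1+2k]^k*k≤[2k]^[1+k] (≤-reflexive (cong (k +_) (sym (+-identityʳ k))))) ⟩
    2 * (2 * (k + k) ^ k)
  ≡⟨ cong (λ z → 2 * (2 * (k + z) ^ k)) (sym (+-identityʳ k)) ⟩
    2 * (2 * (2 * k) ^ k)
  ≡⟨ cong (λ z → 2 * (2 * z)) (^-distribʳ-* 2 k k) ⟩
    2 * (2 * (2 ^ k * k ^ k))
  ≡⟨ solve 2 (λ a c → con 2 :* (con 2 :* (a :* c)) := a :* (con 4 :* c)) refl (2 ^ k) (k ^ k) ⟩
    2 ^ k * (4 * k ^ k)
  ∎)
  where
  open ≤-Reasoning
  [2+2k]^k*[1+k]≤[1+2k]^[1+k] : (2 * suc k) ^ k * suc k ≤ suc (k + k) ^ suc k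
  [2+2k]^k*[1+k]≤[1+2k]^[1+k] = subst₂ (λ u v → u ^ k * suc k ≤ v ^ suc k)
    (solve 1 (λ i → con 1 :+ (i :+ (con 1 :+ i)) := con 2 :* (con 1 :+ i)) refl k) (+-suc k k)
    ([1+j+d]^j*d≤[j+d]^[1+j] k (suc k))
  [1+2k]^k*k≤[2k]^[1+k] : suc (k + k) ^ k * k ≤ (k + k) ^ suc k
  [1+2k]^k*k≤[2k]^[1+k] = [1+j+d]^j*d≤[j+d]^[1+j] k k
  halve : ∀ a d .{{_ : NonZero d}} {c} → c * d ≤ a ^ suc k → a ≤ 2 * d → c ≤ 2 * a ^ k
  halve a d {c} cd≤ a≤2d = *-cancelʳ-≤ c (2 * a ^ k) d (begin
      c * d
    ≤⟨ cd≤ ⟩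
      a * a ^ k
    ≤⟨ *-monoˡ-≤ (a ^ k) a≤2d ⟩
      2 * d * a ^ k
    ≡⟨ solve 2 (λ e x → con 2 :* e :* x := con 2 :* x :* e) refl d (a ^ k) ⟩
      2 * a ^ k * d
    ∎)

allSubsets : ∀ n → List (Subset n)
allSubsets = allVec (true ∷ false ∷ [])

#subsets : ℕ → ℕ → ℕ
#subsets n k = ∑[ Y ∈ allSubsets n ] 𝟙 (∣ Y ∣ ≡ᵇ k)

#subsets-suc : ∀ n k → #subsets (suc n) k ≡ ∑[ Y ∈ allSubsets n ] 𝟙 (suc ∣ Y ∣ ≡ᵇ k) + #subsets n k
#subsets-suc n k = trans (∑-allVec-suc (true ∷ false ∷ []) n (λ Y → 𝟙 (∣ Y ∣ ≡ᵇ k)))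
  (cong (∑[ Y ∈ allSubsets n ] 𝟙 (suc ∣ Y ∣ ≡ᵇ k) +_) (+-identityʳ (#subsets n k)))

#subsets-0 : ∀ n → #subsets n 0 ≡ 1
#subsets-0 zero = refl
#subsets-0 (suc n) = trans (#subsets-suc n 0) (cong₂ _+_ (∑-0 (allSubsets n) (λ _ → refl)) (#subsets-0 n))

#subsets*k^k≤4^k*n^k : ∀ n k → #subsets n k * k ^ k ≤ 4 ^ k * n ^ k
#subsets*k^k≤4^k*n^k zero zero = ≤-refl
#subsets*k^k≤4^k*n^k zero (suc k) = z≤n
#subsets*k^k≤4^k*n^k (suc n) zero = ≤-reflexive (cong (_* 1) (#subsets-0 (suc n)))
#subsets*k^k≤4^k*n^k (suc n) (suc k) = begin
    #subsets (suc n) (suc k) * suc k ^ suc k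
  ≡⟨ cong (_* suc k ^ suc k) (#subsets-suc n (suc k)) ⟩
    (#subsets n k + #subsets n (suc k)) * suc k ^ suc k
  ≡⟨ *-distribʳ-+ (suc k ^ suc k) (#subsets n k) _ ⟩
    #subsets n k * (suc k * suc k ^ k) + #subsets n (suc k) * suc k ^ suc k
  ≤⟨ +-mono-≤ choose-k (#subsets*k^k≤4^k*n^k n (suc k)) ⟩
    suc k * (4 * (4 ^ k * n ^ k)) + 4 ^ suc k * n ^ suc k
  ≡⟨ solve 4 (λ i e x m → (con 1 :+ i) :* (con 4 :* (e :* x)) :+ (con 4 :* e) :* (m :* x) :=
                          (con 4 :* e) :* (m :* x :+ (con 1 :+ i) :* x)) refl k (4 ^ k) (n ^ k) n ⟩
    4 ^ suc k * (n ^ suc k + suc k * n ^ k)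
  ≤⟨ *-monoʳ-≤ (4 ^ suc k) (bernoulli n k) ⟩
    4 ^ suc k * suc n ^ suc k
  ∎
  where
  open ≤-Reasoning
  choose-k : #subsets n k * (suc k * suc k ^ k) ≤ suc k * (4 * (4 ^ k * n ^ k))
  choose-k = begin
      #subsets n k * (suc k * suc k ^ k)
    ≡⟨ solve 3 (λ a c d → a :* (c :* d) := c :* (d :* a)) refl (#subsets n k) (suc k) (suc k ^ k) ⟩
      suc k * (suc k ^ k * #subsets n k)
    ≤⟨ *-monoʳ-≤ (suc k) (*-monoˡ-≤ (#subsets n k) ([1+k]^k≤4*k^k k)) ⟩
      suc k * (4 * k ^ k * #subsets n k)
    ≡⟨ cong (suc k *_) (solve 2 (λ a c → con 4 :* c :* a := con 4 :* (a :* c)) refl (#subsets n k) (k ^ k)) ⟩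
      suc k * (4 * (#subsets n k * k ^ k))
    ≤⟨ *-monoʳ-≤ (suc k) (*-monoʳ-≤ 4 (#subsets*k^k≤4^k*n^k n k)) ⟩
      suc k * (4 * (4 ^ k * n ^ k))
    ∎

∑<-halving : ∀ (E : ℕ → ℕ) B → E 0 ≡ 0 → (∀ k → 2 ^ k * E k ≤ B) → ∀ M → 2 ^ M * ∑< (suc M) E + B ≤ 2 ^ M * B
∑<-halving E B E0≡0 2^kEk≤B zero rewrite E0≡0 | *-identityˡ B = ≤-refl
∑<-halving E B E0≡0 2^kEk≤B (suc M) = begin
    2 * 2 ^ M * ∑< (suc (suc M)) E + B
  ≡⟨ cong (λ z → 2 * 2 ^ M * z + B) (∑<-suc (suc M) E) ⟩
    2 * 2 ^ M * (S + E (suc M)) + B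
  ≡⟨ solve 4 (λ t s e b → con 2 :* t :* (s :+ e) :+ b := con 2 :* (t :* s) :+ con 2 :* t :* e :+ b) refl (2 ^ M) S (E (suc M)) B ⟩
    2 * (2 ^ M * S) + 2 ^ suc M * E (suc M) + B
  ≤⟨ +-monoˡ-≤ B (+-monoʳ-≤ (2 * (2 ^ M * S)) (2^kEk≤B (suc M))) ⟩
    2 * (2 ^ M * S) + B + B
  ≡⟨ solve 2 (λ x b → con 2 :* x :+ b :+ b := con 2 :* (x :+ b)) refl (2 ^ M * S) B ⟩
    2 * (2 ^ M * S + B)
  ≤⟨ *-monoʳ-≤ 2 (∑<-halving E B E0≡0 2^kEk≤B M) ⟩
    2 * (2 ^ M * B)
  ≡⟨ sym (*-assoc 2 (2 ^ M) B) ⟩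
    2 ^ suc M * B
  ∎
  where
  open ≤-Reasoning
  S = ∑< (suc M) E

∑<-halving< : ∀ (E : ℕ → ℕ) B → E 0 ≡ 0 → (∀ k → 2 ^ k * E k ≤ B) → 1 ≤ B → ∀ M → ∑< (suc M) E < B
∑<-halving< E B E0≡0 2^kEk≤B 1≤B M = *-cancelˡ-< (2 ^ M) _ _ (begin-strict
    2 ^ M * ∑< (suc M) E
  <⟨ m<m+n _ 1≤B ⟩
    2 ^ M * ∑< (suc M) E + B
  ≤⟨ ∑<-halving E B E0≡0 2^kEk≤B M ⟩
    2 ^ M * B
  ∎)
  where open ≤-Reasoning

512*[3p+5]≤2^p : ∀ p → 16 ≤ p → 512 * (3 * p + 5) ≤ 2 ^ p
512*[3p+5]≤2^p p 16≤p = subst (λ z → 512 * (3 * z + 5) ≤ 2 ^ z) (m+[n∸m]≡n 16≤p) (from16 (p ∸ 16))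
  where
  from16 : ∀ t → 512 * (3 * (16 + t) + 5) ≤ 2 ^ (16 + t)
  from16 zero = ≤ᵇ⇒≤ (512 * (3 * 16 + 5)) (2 ^ 16) tt
  from16 (suc t) = begin
      512 * (3 * (16 + suc t) + 5)
    ≡⟨ solve 1 (λ x → con 512 :* (con 3 :* (con 16 :+ (con 1 :+ x)) :+ con 5) := con 512 :* (con 3 :* (con 16 :+ x) :+ con 5) :+ con 1536) refl t ⟩
      512 * (3 * (16 + t) + 5) + 1536
    ≤⟨ +-monoʳ-≤ (512 * (3 * (16 + t) + 5)) (≤-trans (≤ᵇ⇒≤ 1536 (512 * (3 * 16 + 5)) tt)
         (*-monoʳ-≤ 512 (+-monoˡ-≤ 5 (*-monoʳ-≤ 3 (m≤m+n 16 t))))) ⟩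
      512 * (3 * (16 + t) + 5) + 512 * (3 * (16 + t) + 5)
    ≤⟨ +-mono-≤ (from16 t) (from16 t) ⟩
      2 ^ (16 + t) + 2 ^ (16 + t)
    ≡⟨ cong (2 ^ (16 + t) +_) (sym (+-identityʳ _)) ⟩
      2 ^ suc (16 + t)
    ∎
    where open ≤-Reasoning

16*r*2^r≤20^p : ∀ r p → 16 ≤ p → r ≤ 3 * p + 5 → 16 * r * 2 ^ r ≤ 20 ^ p
16*r*2^r≤20^p r p 16≤p r≤3p+5 = begin
    16 * r * 2 ^ r
  ≤⟨ *-mono-≤ (*-monoʳ-≤ 16 r≤3p+5) (^-monoʳ-≤ 2 r≤3p+5) ⟩
    16 * (3 * p + 5) * 2 ^ (3 * p + 5)
  ≡⟨ cong (16 * (3 * p + 5) *_) (trans (^-distribˡ-+-* 2 (3 * p) 5) (cong (_* 32) (sym (^-*-assoc 2 3 p)))) ⟩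
    16 * (3 * p + 5) * (8 ^ p * 32)
  ≡⟨ solve 2 (λ x y → con 16 :* x :* (y :* con 32) := con 512 :* x :* y) refl (3 * p + 5) (8 ^ p) ⟩
    512 * (3 * p + 5) * 8 ^ p
  ≤⟨ *-monoˡ-≤ (8 ^ p) (512*[3p+5]≤2^p p 16≤p) ⟩
    2 ^ p * 8 ^ p
  ≡⟨ sym (^-distribʳ-* 2 8 p) ⟩
    16 ^ p
  ≤⟨ ^-monoˡ-≤ p (≤ᵇ⇒≤ 16 20 tt) ⟩
    20 ^ p
  ∎
  where open ≤-Reasoning

2^k*#subsets*2^[rk]*k^[qk]≤b^[qk] : ∀ r p b n k → 16 * r * 2 ^ r ≤ 20 ^ p → 1 ≤ k → 20 * k ≤ b → n ≤ 2 * r * b →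
  2 ^ k * #subsets n k * 2 ^ (r * k) * k ^ (suc p * k) ≤ b ^ (suc p * k)
2^k*#subsets*2^[rk]*k^[qk]≤b^[qk] r p b n k@(suc _) 16r2^r≤20^p _ 20k≤b n≤2rb =
  *-cancelʳ-≤ _ _ (k ^ k) {{m^n≢0 k k}} (begin
    2 ^ k * #subsets n k * 2 ^ (r * k) * k ^ (q * k) * k ^ k
  ≡⟨ solve 5 (λ a N c d e → a :* N :* c :* d :* e := a :* (N :* e) :* c :* d) refl (2 ^ k) (#subsets n k) (2 ^ (r * k)) (k ^ (q * k)) (k ^ k) ⟩
    2 ^ k * (#subsets n k * k ^ k) * 2 ^ (r * k) * k ^ (q * k)
  ≤⟨ *-monoˡ-≤ (k ^ (q * k)) (*-monoˡ-≤ (2 ^ (r * k)) (*-monoʳ-≤ (2 ^ k) (#subsets*k^k≤4^k*n^k n k))) ⟩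
    2 ^ k * (4 ^ k * n ^ k) * 2 ^ (r * k) * k ^ (q * k)
  ≡⟨ sym powers ⟩
    (8 * n * 2 ^ r * k ^ q) ^ k
  ≤⟨ ^-monoˡ-≤ k base ⟩
    (b ^ q * k) ^ k
  ≡⟨ trans (^-distribʳ-* (b ^ q) k k) (cong (_* k ^ k) (^-*-assoc b q k)) ⟩
    b ^ (q * k) * k ^ k
  ∎)
  where
  open ≤-Reasoning
  q = suc p
  powers : (8 * n * 2 ^ r * k ^ q) ^ k ≡ 2 ^ k * (4 ^ k * n ^ k) * 2 ^ (r * k) * k ^ (q * k)
  powers rewrite ^-distribʳ-* (8 * n * 2 ^ r) (k ^ q) k | ^-distribʳ-* (8 * n) (2 ^ r) k
    | ^-distribʳ-* 8 n k | ^-distribʳ-* 2 4 k | ^-*-assoc 2 r k | ^-*-assoc k q k =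
    cong (λ z → z * 2 ^ (r * k) * k ^ (q * k)) (*-assoc (2 ^ k) (4 ^ k) (n ^ k))
  base : 8 * n * 2 ^ r * k ^ q ≤ b ^ q * k
  base = begin
      8 * n * 2 ^ r * (k * k ^ p)
    ≤⟨ *-monoˡ-≤ (k * k ^ p) (*-monoˡ-≤ (2 ^ r) (*-monoʳ-≤ 8 n≤2rb)) ⟩
      8 * (2 * r * b) * 2 ^ r * (k * k ^ p)
    ≡⟨ solve 5 (λ x y t z w → con 8 :* (con 2 :* x :* y) :* t :* (z :* w) := y :* (con 16 :* x :* t :* w) :* z) refl r b (2 ^ r) k (k ^ p) ⟩
      b * (16 * r * 2 ^ r * k ^ p) * k
    ≤⟨ *-monoˡ-≤ k (*-monoʳ-≤ b (*-monoˡ-≤ (k ^ p) 16r2^r≤20^p)) ⟩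
      b * (20 ^ p * k ^ p) * k
    ≡⟨ cong (λ z → b * z * k) (sym (^-distribʳ-* 20 k p)) ⟩
      b * (20 * k) ^ p * k
    ≤⟨ *-monoˡ-≤ k (*-monoʳ-≤ b (^-monoˡ-≤ p 20k≤b)) ⟩
      b ^ q * k
    ∎

-- The block graph

restrict : ∀ {a} {A : Set a} {n} → Subset n → Vec A n → List A
restrict [] [] = []
restrict (true ∷ Y) (x ∷ xs) = x ∷ restrict Y xs
restrict (false ∷ Y) (x ∷ xs) = restrict Y xs

length-restrict : ∀ {a} {A : Set a} {n} (Y : Subset n) (xs : Vec A n) → length (restrict Y xs) ≡ ∣ Y ∣
length-restrict [] [] = refl
length-restrict (true ∷ Y) (x ∷ xs) = cong suc (length-restrict Y xs)
length-restrict (false ∷ Y) (x ∷ xs) = length-restrict Y xs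

∣tabulate∣ : ∀ n (p : ℕ → Bool) → ∣ Vec.tabulate {n = n} (p ∘ toℕ) ∣ ≡ ∑< n (𝟙 ∘ p)
∣tabulate∣ zero p = refl
∣tabulate∣ (suc n) p with p 0
... | true = cong suc (∣tabulate∣ n (p ∘ suc))
... | false = ∣tabulate∣ n (p ∘ suc)

m+n<ᵇm≡false : ∀ b t → (b + t <ᵇ b) ≡ false
m+n<ᵇm≡false zero t = refl
m+n<ᵇm≡false (suc b) t = m+n<ᵇm≡false b t

module BlockGraph {b n : ℕ} where

  open Collisions b

  -- Vertex t = i·b + j with j < b is joined to w iff layer i assigns offset j to w;
  -- the vertices from r·b on are isolated.
  joins : ∀ {r} → Vec (Vec (Fin b) n) r → ℕ → Fin n → Bool
  joins [] t w = false
  joins (xs ∷ G) t w = if t <ᵇ b then toℕ (lookup xs w) ≡ᵇ t else joins G (t ∸ b) w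

  joins-here : ∀ {r} xs (G : Vec _ r) {t} w → t < b → joins (xs ∷ G) t w ≡ (toℕ (lookup xs w) ≡ᵇ t)
  joins-here xs G w t<b rewrite Equivalence.to T-≡ (<⇒<ᵇ t<b) = refl

  joins-later : ∀ {r} xs (G : Vec _ r) t w → joins (xs ∷ G) (b + t) w ≡ joins G t w
  joins-later xs G t w rewrite m+n<ᵇm≡false b t | m+n∸m≡n b t = refl

  joins-beyond : ∀ {r} (G : Vec _ r) t w → joins G (r * b + t) w ≡ false
  joins-beyond [] t w = refl
  joins-beyond {suc r} (xs ∷ G) t w = trans (cong (λ z → joins (xs ∷ G) z w) (+-assoc b (r * b) t))
    (trans (joins-later xs G _ w) (joins-beyond G t w))

  graph : ∀ {r} → Vec (Vec (Fin b) n) r → BipGraph n n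
  graph G v w = joins G (toℕ v) w

  ∑<-joins : ∀ {r} (G : Vec _ r) w → ∑< (r * b) (λ t → 𝟙 (joins G t w)) ≡ r
  ∑<-joins [] w = refl
  ∑<-joins {suc r} (xs ∷ G) w = begin
      ∑< (b + r * b) (λ t → 𝟙 (joins (xs ∷ G) t w))
    ≡⟨ ∑<-+ b (r * b) _ ⟩
      ∑< b (λ t → 𝟙 (joins (xs ∷ G) t w)) + ∑< (r * b) (λ t → 𝟙 (joins (xs ∷ G) (b + t) w))
    ≡⟨ cong₂ _+_ (∑<-cong b (λ t t<b → cong 𝟙 (joins-here xs G w t<b)))
                 (∑<-cong (r * b) (λ t _ → cong 𝟙 (joins-later xs G t w))) ⟩
      ∑< b (λ t → 𝟙 (toℕ (lookup xs w) ≡ᵇ t)) + ∑< (r * b) (λ t → 𝟙 (joins G t w))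
    ≡⟨ cong₂ _+_ (∑<-𝟙≡ᵇ b (toℕ<n (lookup xs w))) (∑<-joins G w) ⟩
      suc r
    ∎
    where open ≡-Reasoning

  degW-graph : ∀ {r} (G : Vec _ r) → r * b ≤ n → ∀ w → degW (graph G) w ≡ r
  degW-graph {r} G rb≤n w = begin
      ∣ Vec.tabulate {n = n} (λ v → joins G (toℕ v) w) ∣
    ≡⟨ ∣tabulate∣ n (λ t → joins G t w) ⟩
      ∑< n (λ t → 𝟙 (joins G t w))
    ≡⟨ ∑<-vanishing _ rb≤n (λ t → cong 𝟙 (joins-beyond G t w)) ⟩
      ∑< (r * b) (λ t → 𝟙 (joins G t w))
    ≡⟨ ∑<-joins G w ⟩
      r
    ∎
    where open ≡-Reasoning

  ∣tabulate∩∣≡occurrences : ∀ {m} (Y : Subset m) (xs : Vec (Fin b) m) j →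
                            ∣ Vec.tabulate (λ w → toℕ (lookup xs w) ≡ᵇ j) ∩ Y ∣ ≡ occurrences j (restrict Y xs)
  ∣tabulate∩∣≡occurrences [] [] j = refl
  ∣tabulate∩∣≡occurrences (true ∷ Y) (x ∷ xs) j with toℕ x ≡ᵇ j
  ... | true = cong suc (∣tabulate∩∣≡occurrences Y xs j)
  ... | false = ∣tabulate∩∣≡occurrences Y xs j
  ∣tabulate∩∣≡occurrences (false ∷ Y) (x ∷ xs) j with toℕ x ≡ᵇ j
  ... | true = ∣tabulate∩∣≡occurrences Y xs j
  ... | false = ∣tabulate∩∣≡occurrences Y xs j

  uniqueNeighbour : ∀ {r} → Vec (Vec (Fin b) n) r → Subset n → ℕ → Bool
  uniqueNeighbour G Y t = ∣ Vec.tabulate (joins G t) ∩ Y ∣ ≡ᵇ 1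

  ∑<-uniqueNeighbour : ∀ {r} (G : Vec _ r) Y →
                       ∑< (r * b) (𝟙 ∘ uniqueNeighbour G Y) ≡ ∑[ xs ∈ toList G ] singletons (restrict Y xs)
  ∑<-uniqueNeighbour [] Y = refl
  ∑<-uniqueNeighbour {suc r} (xs ∷ G) Y = begin
      ∑< (b + r * b) (𝟙 ∘ uniqueNeighbour (xs ∷ G) Y)
    ≡⟨ ∑<-+ b (r * b) _ ⟩
      ∑< b (𝟙 ∘ uniqueNeighbour (xs ∷ G) Y) + ∑< (r * b) (λ t → 𝟙 (uniqueNeighbour (xs ∷ G) Y (b + t)))
    ≡⟨ cong₂ _+_ (∑<-cong b (λ t t<b → cong (λ p → 𝟙 (∣ p ∩ Y ∣ ≡ᵇ 1)) (tabulate-cong (λ w → joins-here xs G w t<b))))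
                 (∑<-cong (r * b) (λ t _ → cong (λ p → 𝟙 (∣ p ∩ Y ∣ ≡ᵇ 1)) (tabulate-cong (joins-later xs G t)))) ⟩
      ∑< b (λ t → 𝟙 (∣ Vec.tabulate (λ w → toℕ (lookup xs w) ≡ᵇ t) ∩ Y ∣ ≡ᵇ 1)) + ∑< (r * b) (𝟙 ∘ uniqueNeighbour G Y)
    ≡⟨ cong₂ _+_ (∑<-cong b (λ t _ → cong (λ c → 𝟙 (c ≡ᵇ 1)) (∣tabulate∩∣≡occurrences Y xs t))) (∑<-uniqueNeighbour G Y) ⟩
      singletons (restrict Y xs) + ∑[ xs ∈ toList G ] singletons (restrict Y xs)
    ∎
    where open ≡-Reasoning

  ∑singletons≤∣Nstar∣ : ∀ {r} (G : Vec _ r) → r * b ≤ n → ∀ Y →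
                        ∑[ xs ∈ toList G ] singletons (restrict Y xs) ≤ ∣ Nstar (graph G) Y ∣
  ∑singletons≤∣Nstar∣ {r} G rb≤n Y = begin
      ∑[ xs ∈ toList G ] singletons (restrict Y xs)
    ≡⟨ sym (∑<-uniqueNeighbour G Y) ⟩
      ∑< (r * b) (𝟙 ∘ uniqueNeighbour G Y)
    ≤⟨ ∑<-monoˡ-≤ _ rb≤n ⟩
      ∑< n (𝟙 ∘ uniqueNeighbour G Y)
    ≡⟨ sym (∣tabulate∣ n (uniqueNeighbour G Y)) ⟩
      ∣ Nstar (graph G) Y ∣
    ∎
    where open ≤-Reasoning

  repeatsIn : ∀ {r} → Vec (Vec (Fin b) n) r → Subset n → ℕ
  repeatsIn G Y = ∑[ xs ∈ toList G ] repeats [] (restrict Y xs)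

  expansion : ∀ {r} q (G : Vec _ r) → r * b ≤ n → 8 * q ≤ 3 * r → ∀ Y →
              repeatsIn G Y ≤ q * ∣ Y ∣ → r * ∣ Y ∣ ≤ 4 * ∣ Nstar (graph G) Y ∣
  expansion {r} q G rb≤n 8q≤3r Y H≤qk = ≤-trans (+-cancelʳ-≤ (3 * (r * k)) (r * k) (4 * U) (begin
      r * k + 3 * (r * k)
    ≡⟨ solve 2 (λ x y → x :* y :+ con 3 :* (x :* y) := con 4 :* (y :* x)) refl r k ⟩
      4 * (k * r)
    ≤⟨ *-monoʳ-≤ 4 kr≤U+2H ⟩
      4 * (U + 2 * H)
    ≤⟨ *-monoʳ-≤ 4 (+-monoʳ-≤ U (*-monoʳ-≤ 2 H≤qk)) ⟩
      4 * (U + 2 * (q * k))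
    ≡⟨ solve 3 (λ u x y → con 4 :* (u :+ con 2 :* (x :* y)) := con 4 :* u :+ con 8 :* x :* y) refl U q k ⟩
      4 * U + 8 * q * k
    ≤⟨ +-monoʳ-≤ (4 * U) (*-monoˡ-≤ k 8q≤3r) ⟩
      4 * U + 3 * r * k
    ≡⟨ cong (4 * U +_) (*-assoc 3 r k) ⟩
      4 * U + 3 * (r * k)
    ∎)) (*-monoʳ-≤ 4 (∑singletons≤∣Nstar∣ G rb≤n Y))
    where
    open ≤-Reasoning
    k = ∣ Y ∣
    U = ∑[ xs ∈ toList G ] singletons (restrict Y xs)
    H = repeatsIn G Y
    kr≤U+2H : k * r ≤ U + 2 * H
    kr≤U+2H = begin
        k * r
      ≡⟨ sym (trans (∑-const (toList G) k) (cong (k *_) (length-toList G))) ⟩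
        ∑[ xs ∈ toList G ] k
      ≤⟨ ∑-mono-≤ (toList G) (λ xs → subst (_≤ singletons (restrict Y xs) + 2 * repeats [] (restrict Y xs))
                                         (length-restrict Y xs) (length≤singletons+2*repeats (restrict Y xs))) ⟩
        ∑[ xs ∈ toList G ] (singletons (restrict Y xs) + 2 * repeats [] (restrict Y xs))
      ≡⟨ trans (∑-distrib-+ (toList G) _ _) (cong (U +_) (∑-*ˡ (toList G) 2 _)) ⟩
        U + 2 * H
      ∎

-- A choice of layers with few repeats

module RepeatStrategy {b : ℕ} where

  open Collisions b
  open BlockGraph

  module _ (K : ℕ) where
    open AdaptiveTests b K

    layerStrategy : ∀ {m L t} (Y : Subset m) (prev : List (Fin b)) → length prev + ∣ Y ∣ ≤ K →
                    Strategy L t → Strategy (m + L) (∣ Y ∣ + t)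
    layerStrategy [] prev _ σ = σ
    layerStrategy (true ∷ Y) prev ≤K σ =
      test (occursIn prev) (≤-trans (∑-occursIn≤length prev) (≤-trans (m≤m+n _ _) ≤K))
           (λ x → layerStrategy Y (x ∷ prev) (subst (_≤ K) (+-suc (length prev) ∣ Y ∣) ≤K) σ)
    layerStrategy (false ∷ Y) prev ≤K σ = read (λ _ → layerStrategy Y prev ≤K σ)

    passed-layerStrategy : ∀ {m L t} (Y : Subset m) prev ≤K (σ : Strategy L t) xs ys →
                           passed (layerStrategy Y prev ≤K σ) (xs Vec.++ ys) ≡ repeats prev (restrict Y xs) + passed σ ys
    passed-layerStrategy [] prev ≤K σ [] ys = refl
    passed-layerStrategy (true ∷ Y) prev ≤K σ (x ∷ xs) ys =
      trans (cong (𝟙 (occursIn prev x) +_) (passed-layerStrategy Y (x ∷ prev) _ σ xs ys))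
            (sym (+-assoc (𝟙 (occursIn prev x)) _ (passed σ ys)))
    passed-layerStrategy (false ∷ Y) prev ≤K σ (x ∷ xs) ys = passed-layerStrategy Y prev ≤K σ xs ys

  repeatStrategy : ∀ {n} (Y : Subset n) r → AdaptiveTests.Strategy b ∣ Y ∣ (r * n) (r * ∣ Y ∣)
  repeatStrategy Y zero = AdaptiveTests.stop
  repeatStrategy Y (suc r) = layerStrategy ∣ Y ∣ Y [] ≤-refl (repeatStrategy Y r)

  passed-repeatStrategy : ∀ {n r} (Y : Subset n) (G : Vec (Vec (Fin b) n) r) →
                          AdaptiveTests.passed b ∣ Y ∣ (repeatStrategy Y r) (concat G) ≡ repeatsIn G Y
  passed-repeatStrategy Y [] = refl
  passed-repeatStrategy Y (xs ∷ G) = trans (passed-layerStrategy ∣ Y ∣ Y [] ≤-refl _ xs (concat G))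
    (cong (repeats [] (restrict Y xs) +_) (passed-repeatStrategy Y G))

module GoodChoice (r n b p : ℕ) .{{_ : NonZero b}} (16r2^r≤20^p : 16 * r * 2 ^ r ≤ 20 ^ p)
                  (n≤2rb : n ≤ 2 * r * b) (20k≤b : ∀ k → 20 * r * k ≤ n → 20 * k ≤ b) where

  open AdaptiveTests using (#passing≥; #passing≥-bound; passed)
  open BlockGraph {b} {n}
  open RepeatStrategy {b}

  q : ℕ
  q = suc p

  choices : List (Vec (Fin b) (r * n))
  choices = allVec (allFin b) (r * n)

  layers : Vec (Fin b) (r * n) → Vec (Vec (Fin b) n) r
  layers F = proj₁ (Vec.group r n F)

  admissible : ℕ → Bool
  admissible k = (0 <ᵇ k) ∧ (20 * r * k ≤ᵇ n)

  bad : Vec (Fin b) (r * n) → Subset n → ℕ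
  bad F Y = 𝟙 (admissible ∣ Y ∣) * 𝟙 (q * ∣ Y ∣ ≤ᵇ repeatsIn (layers F) Y)

  #badChoices : Subset n → ℕ
  #badChoices Y = ∑[ F ∈ choices ] 𝟙 (q * ∣ Y ∣ ≤ᵇ repeatsIn (layers F) Y)

  #badChoices-bound : ∀ Y → #badChoices Y * b ^ (q * ∣ Y ∣) ≤ 2 ^ (r * ∣ Y ∣) * ∣ Y ∣ ^ (q * ∣ Y ∣) * b ^ (r * n)
  #badChoices-bound Y = subst (λ c → c * b ^ (q * ∣ Y ∣) ≤ 2 ^ (r * ∣ Y ∣) * ∣ Y ∣ ^ (q * ∣ Y ∣) * b ^ (r * n))
    (∑-cong choices passed≡repeats) (#passing≥-bound b ∣ Y ∣ (repeatStrategy Y r) (q * ∣ Y ∣))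
    where
    passed≡repeats : ∀ F → 𝟙 (q * ∣ Y ∣ ≤ᵇ passed b ∣ Y ∣ (repeatStrategy Y r) F) ≡ 𝟙 (q * ∣ Y ∣ ≤ᵇ repeatsIn (layers F) Y)
    passed≡repeats F = cong (λ h → 𝟙 (q * ∣ Y ∣ ≤ᵇ h))
      (trans (cong (passed b ∣ Y ∣ (repeatStrategy Y r)) (proj₂ (Vec.group r n F))) (passed-repeatStrategy Y (layers F)))

  #bad-ofSize : ℕ → ℕ
  #bad-ofSize k = ∑[ Y ∈ allSubsets n ] (𝟙 (∣ Y ∣ ≡ᵇ k) * (𝟙 (admissible k) * #badChoices Y))

  ∑∑bad≡∑<#bad-ofSize : ∑[ F ∈ choices ] ∑[ Y ∈ allSubsets n ] bad F Y ≡ ∑< (suc n) #bad-ofSize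
  ∑∑bad≡∑<#bad-ofSize = begin
      ∑[ F ∈ choices ] ∑[ Y ∈ allSubsets n ] bad F Y
    ≡⟨ ∑-comm choices (allSubsets n) bad ⟩
      ∑[ Y ∈ allSubsets n ] ∑[ F ∈ choices ] bad F Y
    ≡⟨ ∑-cong (allSubsets n) (λ Y → ∑-*ˡ choices (𝟙 (admissible ∣ Y ∣)) _) ⟩
      ∑[ Y ∈ allSubsets n ] (𝟙 (admissible ∣ Y ∣) * #badChoices Y)
    ≡⟨ ∑-by-size (allSubsets n) ∣_∣ (suc n) (λ Y k → 𝟙 (admissible k) * #badChoices Y) (s≤s ∘ ∣p∣≤n) ⟩
      ∑< (suc n) #bad-ofSize
    ∎
    where open ≡-Reasoning

  2^k*#bad-ofSize≤#choices : ∀ k → 2 ^ k * #bad-ofSize k ≤ b ^ (r * n)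
  2^k*#bad-ofSize≤#choices k with admissible k in adm
  ... | false = ≤-trans (≤-reflexive (trans (cong (2 ^ k *_) (∑-0 (allSubsets n) (λ Y → *-zeroʳ (𝟙 (∣ Y ∣ ≡ᵇ k)))))
                                               (*-zeroʳ (2 ^ k)))) z≤n
  ... | true = *-cancelʳ-≤ _ _ (b ^ (q * k)) {{m^n≢0 b (q * k)}} (begin
      2 ^ k * ∑[ Y ∈ allSubsets n ] (𝟙 (∣ Y ∣ ≡ᵇ k) * (1 * #badChoices Y)) * b ^ (q * k)
    ≡⟨ cong (_* b ^ (q * k)) (cong (2 ^ k *_) (∑-cong (allSubsets n) (λ Y → cong (𝟙 (∣ Y ∣ ≡ᵇ k) *_) (+-identityʳ _)))) ⟩
      2 ^ k * D * b ^ (q * k)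
    ≡⟨ trans (*-assoc (2 ^ k) D _) (cong (2 ^ k *_) (trans (sym (∑-*ʳ (allSubsets n) _ _))
                                                          (∑-cong (allSubsets n) (λ Y → *-assoc (𝟙 (∣ Y ∣ ≡ᵇ k)) _ _)))) ⟩
      2 ^ k * ∑[ Y ∈ allSubsets n ] (𝟙 (∣ Y ∣ ≡ᵇ k) * (#badChoices Y * b ^ (q * k)))
    ≤⟨ *-monoʳ-≤ (2 ^ k) (∑[𝟙*g]≤∑𝟙*C (allSubsets n) (λ Y → ∣ Y ∣ ≡ᵇ k) _ _ ofSize-k) ⟩
      2 ^ k * (#subsets n k * (2 ^ (r * k) * k ^ (q * k) * b ^ (r * n)))
    ≡⟨ solve 5 (λ a N c d B → a :* (N :* (c :* d :* B)) := a :* N :* c :* d :* B) refl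
               (2 ^ k) (#subsets n k) (2 ^ (r * k)) (k ^ (q * k)) (b ^ (r * n)) ⟩
      2 ^ k * #subsets n k * 2 ^ (r * k) * k ^ (q * k) * b ^ (r * n)
    ≤⟨ *-monoˡ-≤ (b ^ (r * n)) (2^k*#subsets*2^[rk]*k^[qk]≤b^[qk] r p b n k 16r2^r≤20^p
                                  (<ᵇ⇒< 0 k (proj₁ conditions)) (20k≤b k (≤ᵇ⇒≤ _ n (proj₂ conditions))) n≤2rb) ⟩
      b ^ (q * k) * b ^ (r * n)
    ≡⟨ *-comm (b ^ (q * k)) _ ⟩
      b ^ (r * n) * b ^ (q * k)
    ∎)
    where
    open ≤-Reasoning
    conditions : T (0 <ᵇ k) × T (20 * r * k ≤ᵇ n)
    conditions = Equivalence.to T-∧ (Equivalence.from T-≡ adm)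
    D : ℕ
    D = ∑[ Y ∈ allSubsets n ] (𝟙 (∣ Y ∣ ≡ᵇ k) * #badChoices Y)
    ofSize-k : ∀ Y → T (∣ Y ∣ ≡ᵇ k) → #badChoices Y * b ^ (q * k) ≤ 2 ^ (r * k) * k ^ (q * k) * b ^ (r * n)
    ofSize-k Y ∣Y∣≡k with ≡ᵇ⇒≡ ∣ Y ∣ k ∣Y∣≡k
    ... | refl = #badChoices-bound Y

  ∃good : ∃ λ G → ∀ Y → 0 < ∣ Y ∣ → 20 * r * ∣ Y ∣ ≤ n → repeatsIn G Y < q * ∣ Y ∣
  ∃good = layers F , good
    where
    ∑∑bad<#choices : ∑[ F ∈ choices ] ∑[ Y ∈ allSubsets n ] bad F Y < length choices
    ∑∑bad<#choices = subst₂ _<_ (sym ∑∑bad≡∑<#bad-ofSize)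
      (sym (trans (length-allVec (allFin b) (r * n)) (cong (_^ (r * n)) (length-tabulate (λ i → i)))))
      (∑<-halving< #bad-ofSize (b ^ (r * n)) (∑-0 (allSubsets n) (λ Y → *-zeroʳ (𝟙 (∣ Y ∣ ≡ᵇ 0))))
                   2^k*#bad-ofSize≤#choices (m^n>0 b (r * n)) n)
    found : ∃ λ F → ∑[ Y ∈ allSubsets n ] bad F Y ≡ 0
    found = ∑<length⇒∃≡0 choices _ ∑∑bad<#choices
    F = proj₁ found
    noBad : ∀ Y → bad F Y ≡ 0
    noBad Y = n≤0⇒n≡0 (≤-trans (∈⇒≤∑ (bad F) (∈-allVec (λ { true → here refl ; false → there (here refl) }) Y))
                                (≤-reflexive (proj₂ found)))
    good : ∀ Y → 0 < ∣ Y ∣ → 20 * r * ∣ Y ∣ ≤ n → repeatsIn (layers F) Y < q * ∣ Y ∣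
    good Y 0<k 20rk≤n = ≰⇒> qk≰H
      where
      adm : admissible ∣ Y ∣ ≡ true
      adm = Equivalence.to T-≡ (Equivalence.from T-∧ (<⇒<ᵇ 0<k , ≤⇒≤ᵇ 20rk≤n))
      qk≰H : q * ∣ Y ∣ ≰ repeatsIn (layers F) Y
      qk≰H qk≤H = 1+n≢0 (trans (sym (cong₂ (λ a c → 𝟙 a * 𝟙 c) adm (Equivalence.to T-≡ (≤⇒≤ᵇ qk≤H)))) (noBad Y))

Nonempty⇒∣p∣>0 : ∀ {n} {p : Subset n} → Nonempty p → 0 < ∣ p ∣
Nonempty⇒∣p∣>0 {p = p} (x , x∈p) = subst (_≤ ∣ p ∣) (∣⁅x⁆∣≡1 x)
  (p⊆q⇒∣p∣≤∣q∣ (λ y∈⁅x⁆ → subst (_∈ₛ p) (sym (x∈⁅y⁆⇒x≡y x y∈⁅x⁆)) x∈p))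

blockExpander : ∀ r n b p .{{_ : NonZero b}} → r * b ≤ n → n ≤ 2 * r * b → (∀ k → 20 * r * k ≤ n → 20 * k ≤ b) →
                16 * r * 2 ^ r ≤ 20 ^ p → 8 * suc p ≤ 3 * r → 4 < r →
                Σ (BipGraph n n) (λ E → ((w : Fin n) → degW E w ≡ r) × SingleNeighborExpander E r 4 1 (20 * r))
blockExpander r n b p rb≤n n≤2rb 20k≤b 16r2^r≤20^p 8q≤3r 4<r = graph G , degW-graph G rb≤n , record
  { γ-pos = z<s
  ; γ-lt-1 = ≤-trans (≤ᵇ⇒≤ 2 20 tt) (*-monoʳ-≤ 20 (≤-trans z<s 4<r))
  ; α-gt-1 = 4<r
  ; expand = λ Y nonempty 20rk≤n → expansion (suc p) G rb≤n 8q≤3r Y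
      (<⇒≤ (proj₂ ∃good Y (Nonempty⇒∣p∣>0 nonempty) (subst (20 * r * ∣ Y ∣ ≤_) (+-identityʳ n) 20rk≤n)))
  }
  where
  open GoodChoice r n b p 16r2^r≤20^p n≤2rb 20k≤b
  open BlockGraph {b} {n}
  G = proj₁ ∃good

-- Blocks of size n / r, and at most (r / 3)·|Y| repeats allowed.
expander : ∀ r → 51 ≤ r → ∀ n → 4 * r ≤ n →
           Σ (BipGraph n n) (λ E → ((w : Fin n) → degW E w ≡ r) × SingleNeighborExpander E r 4 1 (20 * r))
expander r@(suc _) 51≤r n 4r≤n = blockExpander r n b p {{>-nonZero (≤-trans z<s 4≤b)}}
  (subst (_≤ n) (*-comm b r) (m/n*n≤m n r)) n≤2rb 20k≤b
  (16*r*2^r≤20^p r p (≤-pred (subst (17 ≤_) (sym suc-p≡q) (/-monoˡ-≤ 3 51≤r))) r≤3p+5)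
  8q≤3r (≤-trans (≤ᵇ⇒≤ 5 51 tt) 51≤r)
  where
  open ≤-Reasoning
  b = n / r
  q = r / 3
  p = pred q
  4≤b : 4 ≤ b
  4≤b = subst (_≤ b) (m*n/n≡m 4 r) (/-monoˡ-≤ r 4r≤n)
  n<[1+b]*r : n < suc b * r
  n<[1+b]*r = begin-strict
      n
    ≡⟨ m≡m%n+[m/n]*n n r ⟩
      n % r + b * r
    <⟨ +-monoˡ-< (b * r) (m%n<n n r) ⟩
      suc b * r
    ∎
  n≤2rb : n ≤ 2 * r * b
  n≤2rb = begin
      n
    ≤⟨ <⇒≤ n<[1+b]*r ⟩
      r + b * r
    ≤⟨ +-monoˡ-≤ (b * r) (m≤n*m r b {{>-nonZero (≤-trans z<s 4≤b)}}) ⟩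
      b * r + b * r
    ≡⟨ solve 2 (λ x y → y :* x :+ y :* x := con 2 :* x :* y) refl r b ⟩
      2 * r * b
    ∎
  20k≤b : ∀ k → 20 * r * k ≤ n → 20 * k ≤ b
  20k≤b k 20rk≤n = ≤-pred (*-cancelʳ-< r (20 * k) (suc b) (begin-strict
      20 * k * r
    ≡⟨ solve 3 (λ x y z → x :* y :* z := x :* z :* y) refl 20 k r ⟩
      20 * r * k
    ≤⟨ 20rk≤n ⟩
      n
    <⟨ n<[1+b]*r ⟩
      suc b * r
    ∎))
  suc-p≡q : suc p ≡ q
  suc-p≡q = suc-pred q {{>-nonZero (≤-trans z<s (/-monoˡ-≤ 3 51≤r))}}
  r≤3p+5 : r ≤ 3 * p + 5
  r≤3p+5 = begin
      r
    ≡⟨ m≡m%n+[m/n]*n r 3 ⟩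
      r % 3 + q * 3
    ≤⟨ +-monoˡ-≤ (q * 3) (≤-pred (m%n<n r 3)) ⟩
      2 + q * 3
    ≡⟨ cong (λ z → 2 + z * 3) (sym suc-p≡q) ⟩
      2 + suc p * 3
    ≡⟨ solve 1 (λ x → con 2 :+ (con 1 :+ x) :* con 3 := con 3 :* x :+ con 5) refl p ⟩
      3 * p + 5
    ∎
  8q≤3r : 8 * suc p ≤ 3 * r
  8q≤3r = begin
      8 * suc p
    ≡⟨ cong (8 *_) suc-p≡q ⟩
      8 * q
    ≤⟨ *-monoˡ-≤ q (≤ᵇ⇒≤ 8 9 tt) ⟩
      9 * q
    ≡⟨ solve 1 (λ x → con 9 :* x := con 3 :* (x :* con 3)) refl q ⟩
      3 * (q * 3)
    ≤⟨ *-monoʳ-≤ 3 (m/n*n≤m r 3) ⟩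
      3 * r
    ∎

corollary5p10 : Σ ℕ (λ R₀ → 5 ≤ R₀ ×
    ((r : ℕ) → R₀ ≤ r → (n : ℕ) → 4 * r ≤ n →
      Σ (BipGraph n n) (λ E →
        ((w : Fin n) → degW E w ≡ r) ×
        SingleNeighborExpander E r 4 1 (20 * r))))
corollary5p10 = 51 , ≤ᵇ⇒≤ 5 51 tt , expander
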